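{- For all integers $n\ge1$ and $0\le k\le n$, $$c_q[n,k]=\sum_{T\in\mathcal{AR}(n,n-k)} q^{\mathrm{below}(T)}(1+q)^{\mathrm{nrow}(T)}.$$
   Context: The staircase board of length $m$ consists of the squares $(i,j)$ with integers $i,j\ge1$ and $i+j\le m$; $i$ is the row (row $1$ is the top row, with $m-1$ squares) and $j$ the column (numbered from the left; column $j$ has $m-j$ squares, left-justified rows). The squares below $(i,j)$ are the squares $(i',j)$ with $i'>i$; there are $m-i-j$ of them. Square $(i,j)$ is shaded if $m-i-j$ is even (so every other antidiagonal is shaded, starting with the lowest one). A placement of $r$ rooks is a set of $r$ squares, no two in the same column (two rooks may share a row); $\mathcal R(m,r)$ denotes the set of such placements, and $\mathcal{AR}(m,r)$ the subset in which every rook is on a shaded square. For a placement $T$, $\mathrm{below}(T)$ is the total number of squares lying below the rooks of $T$, and $\mathrm{nrow}(T)$ is the number of rooks of $T$ not in row $1$. Let $[k]_q=1+q+\cdots+q^{k-1}$ ($[0]_q=0$). The unsigned $q$-Stirling numbers of the first kind are defined by $c_q[n,k]=c_q[n-1,k-1]+[n-1]_q\,c_q[n-1,k]$ for $n\ge1$, $k\ge1$, with $c_q[n,0]=\delta_{n,0}$ and $c_q[n,k]=0$ for $k>n$. -}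

module Defs where

open import Level using (Level)
open import Data.Nat using (ℕ; zero; suc; _+_; _∸_; _%_; _≡ᵇ_)
import Data.Bool
open import Data.Bool using (Bool; not; _∧_)
open import Data.Product using (_×_; _,_)
open import Data.List using (List; []; _∷_; map; concatMap; upTo; length; filterᵇ; foldr)
open import Algebra.Bundles using (CommutativeSemiring)

-- A square of the staircase board is a pair (i , j) : row i, column j.
Square : Set
Square = ℕ × ℕ

-- A rook placement is recorded as the list of its squares, ordered by
-- increasing column; each column holds at most one rook.
Placement : Set
Placement = List Square

rows : ℕ → List ℕ
rows n = map suc (upTo n)

-- All rook placements (any number of rooks) on the staircase board of
-- length m, using columns j, j+1, ..., j+t-1 (each column j' having rows
-- 1 .. m - j'), each column either empty or holding exactly one rook.
placementsFrom : ℕ → ℕ → ℕ → List Placement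
placementsFrom m zero    j = [] ∷ []
placementsFrom m (suc t) j =
  concatMap (λ rest → rest ∷ map (λ i → (i , j) ∷ rest) (rows (m ∸ j)))
            (placementsFrom m t (suc j))

allPlacements : ℕ → List Placement
allPlacements m = placementsFrom m (m ∸ 1) 1

belowSq : ℕ → Square → ℕ
belowSq m (i , j) = m ∸ (i + j)

shaded : ℕ → Square → Bool
shaded m s = (belowSq m s % 2) ≡ᵇ 0

R : ℕ → ℕ → List Placement
R m r = filterᵇ (λ T → length T ≡ᵇ r) (allPlacements m)

allᵇ : {A : Set} → (A → Bool) → List A → Bool
allᵇ p [] = Data.Bool.true
allᵇ p (x ∷ xs) = p x ∧ allᵇ p xs

AR : ℕ → ℕ → List Placement
AR m r = filterᵇ (allᵇ (shaded m)) (R m r)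

below : ℕ → Placement → ℕ
below m T = foldr (λ s acc → belowSq m s + acc) 0 T

nrow : Placement → ℕ
nrow T = length (filterᵇ (λ { (i , j) → not (i ≡ᵇ 1) }) T)

-- Polynomial expressions in q, evaluated in an arbitrary commutative
-- semiring (an identity for all commutative semirings and all q is the
-- same as an identity in ℕ[q]).
module Poly {c ℓ : Level} (S : CommutativeSemiring c ℓ) (q : CommutativeSemiring.Carrier S) where
  open CommutativeSemiring S using (Carrier; 0#; 1#) renaming (_+_ to _⊕_; _*_ to _⊗_)

  pow : Carrier → ℕ → Carrier
  pow x zero    = 1#
  pow x (suc n) = x ⊗ pow x n

  qint : ℕ → Carrier
  qint zero    = 0#
  qint (suc k) = qint k ⊕ pow q k

  cq : ℕ → ℕ → Carrier
  cq zero    zero    = 1#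
  cq zero    (suc k) = 0#
  cq (suc n) zero    = 0#
  cq (suc n) (suc k) = cq n k ⊕ (qint n ⊗ cq n (suc k))

  weight : ℕ → Placement → Carrier
  weight m T = pow q (below m T) ⊗ pow (1# ⊕ q) (nrow T)

  sumList : List Carrier → Carrier
  sumList = foldr _⊕_ 0#

  rookSum : ℕ → ℕ → Carrier
  rookSum m r = sumList (map (weight m) (AR m r))

module Submission where

-- Both sides are identified with elementary symmetric functions of
-- q-integers, e_r(x₁, …, x_t) = Σ_{i₁ < … < i_r} x_{i₁} ⋯ x_{i_r}.
--
-- Stirling side: the recurrence c_q[n+1,k+1] = c_q[n,k] + [n]_q c_q[n,k+1]
-- is the recurrence of e_{n-k}([n-1]_q, …, [1]_q), so
-- c_q[t+1,k] = e_{t+1-k}([t]_q, …, [1]_q).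
--
-- Rook side: a placement is built column by column, each column either
-- empty or holding one rook, and the weight q^below (1+q)^nrow is a
-- product of one factor per rook.  The key computation is that the shaded
-- squares of a single column of height h contribute exactly [h]_q in total
-- (lengthening the column by two squares multiplies the weights of the old
-- rows by q², and the two new lowest squares contribute 0 and 1 + q).  Hence a board whose columns have
-- heights h₁, …, h_t has weighted r-rook sum e_r([h₁]_q, …, [h_t]_q); the
-- staircase of length t+1 has heights t, …, 1, which gives the theorem.

open import Defs
open import Level using (Level)
open import Algebra.Bundles using (CommutativeSemiring)
open import Data.Bool using (true; false; if_then_else_; not)
open import Data.Nat using (ℕ; zero; suc; pred; _≤_; _<_; _∸_; _%_; _≡ᵇ_; s≤s) renaming (_+_ to _+ℕ_)
open import Data.Nat.Properties using (≤-refl; ≤-reflexive; m≤n⇒m≤1+n; m≤n⇒m<n∨m≡n; +-∸-assoc; ∸-+-assoc; m+n∸n≡m; n∸n≡0; pred[m∸n]≡m∸[1+n])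
  renaming (+-comm to +ℕ-comm)
open import Data.Product using (_,_)
open import Data.Sum using (inj₁; inj₂)
open import Data.List using (List; []; _∷_; _++_; [_]; map; concat; length; filterᵇ; upTo; applyDownFrom)
open import Data.List.Properties using (map-∘; upTo-∷ʳ; length-applyDownFrom)
open import Function using (_∘_)
open import Relation.Binary.PropositionalEquality as ≡ using (_≡_)
import Relation.Binary.Reasoning.Setoid as SetoidReasoning
import Algebra.Properties.CommutativeSemigroup as CommutativeSemigroupProperties
import Algebra.Solver.Ring.NaturalCoefficients.Default as NaturalSolver

module RookStirling {c ℓ : Level} (S : CommutativeSemiring c ℓ) (q : CommutativeSemiring.Carrier S) where
  open CommutativeSemiring S hiding (zero) renaming (_+_ to _⊕_; _*_ to _⊗_)
  open Poly S q
  open SetoidReasoning setoid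
  open CommutativeSemigroupProperties *-commutativeSemigroup using (interchange)
  open NaturalSolver S using (solve; _:=_; _:+_; _:*_; con)

  sum-cong : {A : Set} {f g : A → Carrier} → (∀ x → f x ≈ g x) →
             ∀ xs → sumList (map f xs) ≈ sumList (map g xs)
  sum-cong e []       = refl
  sum-cong e (x ∷ xs) = +-cong (e x) (sum-cong e xs)

  sum-++ : {A : Set} (f : A → Carrier) → ∀ xs ys →
           sumList (map f (xs ++ ys)) ≈ sumList (map f xs) ⊕ sumList (map f ys)
  sum-++ f []       ys = sym (+-identityˡ _)
  sum-++ f (x ∷ xs) ys = trans (+-congˡ (sum-++ f xs ys)) (sym (+-assoc _ _ _))

  sum-+ : {A : Set} (f g : A → Carrier) → ∀ xs →
          sumList (map (λ x → f x ⊕ g x) xs) ≈ sumList (map f xs) ⊕ sumList (map g xs)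
  sum-+ f g []       = sym (+-identityˡ _)
  sum-+ f g (x ∷ xs) = trans (+-congˡ (sum-+ f g xs)) (solve 4
    (λ a b u v → (a :+ b) :+ (u :+ v) := (a :+ u) :+ (b :+ v)) refl (f x) (g x) _ _)

  sum-*ˡ : {A : Set} (a : Carrier) (f : A → Carrier) → ∀ xs →
           sumList (map (λ x → a ⊗ f x) xs) ≈ a ⊗ sumList (map f xs)
  sum-*ˡ a f []       = sym (zeroʳ a)
  sum-*ˡ a f (x ∷ xs) = trans (+-congˡ (sum-*ˡ a f xs)) (sym (distribˡ a _ _))

  sum-*ʳ : {A : Set} (a : Carrier) (f : A → Carrier) → ∀ xs →
           sumList (map (λ x → f x ⊗ a) xs) ≈ sumList (map f xs) ⊗ a
  sum-*ʳ a f []       = sym (zeroˡ a)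
  sum-*ʳ a f (x ∷ xs) = trans (+-congˡ (sum-*ʳ a f xs)) (sym (distribʳ a _ _))

  -- A sum of zeros vanishes (extensions by a rook never count as 0-rook placements).
  sum-zero : {A : Set} (xs : List A) → sumList (map (λ _ → 0#) xs) ≈ 0#
  sum-zero []       = refl
  sum-zero (x ∷ xs) = trans (+-identityˡ _) (sum-zero xs)

  ∑< : ℕ → (ℕ → Carrier) → Carrier
  ∑< zero    f = 0#
  ∑< (suc h) f = ∑< h f ⊕ f h

  ∑<-cong : ∀ h {f g : ℕ → Carrier} → (∀ i → i < h → f i ≈ g i) → ∑< h f ≈ ∑< h g
  ∑<-cong zero    e = refl
  ∑<-cong (suc h) e = +-cong (∑<-cong h (λ i i<h → e i (m≤n⇒m≤1+n i<h))) (e h ≤-refl)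

  ∑<-*ˡ : ∀ h a (f : ℕ → Carrier) → ∑< h (λ i → a ⊗ f i) ≈ a ⊗ ∑< h f
  ∑<-*ˡ zero    a f = sym (zeroʳ a)
  ∑<-*ˡ (suc h) a f = trans (+-congʳ (∑<-*ˡ h a f)) (sym (distribˡ a _ _))

  sum-upTo : ∀ (f : ℕ → Carrier) h → sumList (map f (upTo h)) ≈ ∑< h f
  sum-upTo f zero    = refl
  sum-upTo f (suc h) = begin
    sumList (map f (upTo (suc h)))                  ≡⟨ ≡.cong (sumList ∘ map f) (≡.sym (upTo-∷ʳ h)) ⟩
    sumList (map f (upTo h ++ [ h ]))               ≈⟨ sum-++ f (upTo h) [ h ] ⟩
    sumList (map f (upTo h)) ⊕ (f h ⊕ 0#)           ≈⟨ +-cong (sum-upTo f h) (+-identityʳ (f h)) ⟩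
    ∑< h f ⊕ f h                                    ∎

  pow-+ : ∀ x a b → pow x (a +ℕ b) ≈ pow x a ⊗ pow x b
  pow-+ x zero    b = sym (*-identityˡ _)
  pow-+ x (suc a) b = trans (*-congˡ (pow-+ x a b)) (sym (*-assoc _ _ _))

  qint-suc : ∀ k → qint (suc k) ≈ 1# ⊕ q ⊗ qint k
  qint-suc zero    = trans (+-identityˡ _) (sym (trans (+-congˡ (zeroʳ q)) (+-identityʳ _)))
  qint-suc (suc k) = begin
    qint (suc k) ⊕ q ⊗ pow q k          ≈⟨ +-congʳ (qint-suc k) ⟩
    (1# ⊕ q ⊗ qint k) ⊕ q ⊗ pow q k     ≈⟨ +-assoc _ _ _ ⟩
    1# ⊕ (q ⊗ qint k ⊕ q ⊗ pow q k)     ≈⟨ +-congˡ (sym (distribˡ q _ _)) ⟩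
    1# ⊕ q ⊗ qint (suc k)               ∎

  qint-2+ : ∀ h → qint (suc (suc h)) ≈ (q ⊗ q) ⊗ qint h ⊕ (1# ⊕ q)
  qint-2+ h = begin
    qint (suc (suc h))            ≈⟨ trans (qint-suc (suc h)) (+-congˡ (*-congˡ (qint-suc h))) ⟩
    1# ⊕ q ⊗ (1# ⊕ q ⊗ qint h)    ≈⟨ solve 2 (λ x y → con 1 :+ x :* (con 1 :+ x :* y)
                                                   := (x :* x) :* y :+ (con 1 :+ x)) refl q (qint h) ⟩
    (q ⊗ q) ⊗ qint h ⊕ (1# ⊕ q)   ∎

  offTop : ℕ → ℕ
  offTop i = if not (i ≡ᵇ 1) then 1 else 0

  -- Weight of a rook in row i of a column of height h: it has h ∸ i
  -- squares below it, and only shaded squares (h ∸ i even) are allowed.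
  cellWeight : ℕ → ℕ → Carrier
  cellWeight h i = if (h ∸ i) % 2 ≡ᵇ 0 then pow q (h ∸ i) ⊗ pow (1# ⊕ q) (offTop i) else 0#

  -- Adding two squares at the bottom keeps the shading of row i+1 ≤ h and
  -- puts two more squares below it.
  cellWeight-lift : ∀ h i → i < h → cellWeight (suc (suc h)) (suc i) ≈ (q ⊗ q) ⊗ cellWeight h (suc i)
  cellWeight-lift h i i<h rewrite +-∸-assoc 2 i<h with (h ∸ suc i) % 2 ≡ᵇ 0
  ... | true  = trans (*-congʳ (sym (*-assoc q q _))) (*-assoc (q ⊗ q) _ _)
  ... | false = sym (zeroʳ _)

  cellWeight-unshaded : ∀ h → cellWeight (suc (suc h)) (suc h) ≡ 0#
  cellWeight-unshaded h rewrite m+n∸n≡m 1 h = ≡.refl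

  cellWeight-lowest : ∀ h → cellWeight (suc (suc h)) (suc (suc h)) ≈ 1# ⊕ q
  cellWeight-lowest h rewrite n∸n≡0 h = trans (*-identityˡ _) (*-identityʳ _)

  columnIndexSum : ∀ h → ∑< h (cellWeight h ∘ suc) ≈ qint h
  columnIndexSum zero          = refl
  columnIndexSum (suc zero)    = +-congˡ (*-identityˡ _)
  columnIndexSum (suc (suc h)) = begin
    (∑< h (cellWeight (2 +ℕ h) ∘ suc) ⊕ cellWeight (2 +ℕ h) (suc h)) ⊕ cellWeight (2 +ℕ h) (2 +ℕ h)
      ≈⟨ +-cong (+-cong (∑<-cong h (cellWeight-lift h)) (reflexive (cellWeight-unshaded h))) (cellWeight-lowest h) ⟩
    (∑< h (λ i → (q ⊗ q) ⊗ cellWeight h (suc i)) ⊕ 0#) ⊕ (1# ⊕ q)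
      ≈⟨ +-congʳ (trans (+-identityʳ _) (∑<-*ˡ h (q ⊗ q) (cellWeight h ∘ suc))) ⟩
    (q ⊗ q) ⊗ ∑< h (cellWeight h ∘ suc) ⊕ (1# ⊕ q)
      ≈⟨ +-congʳ (*-congˡ (columnIndexSum h)) ⟩
    (q ⊗ q) ⊗ qint h ⊕ (1# ⊕ q)
      ≈⟨ sym (qint-2+ h) ⟩
    qint (2 +ℕ h) ∎

  columnSum : ∀ h → sumList (map (cellWeight h) (rows h)) ≈ qint h
  columnSum h = begin
    sumList (map (cellWeight h) (map suc (upTo h)))  ≡⟨ ≡.cong sumList (≡.sym (map-∘ (upTo h))) ⟩
    sumList (map (cellWeight h ∘ suc) (upTo h))      ≈⟨ sum-upTo (cellWeight h ∘ suc) h ⟩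
    ∑< h (cellWeight h ∘ suc)                         ≈⟨ columnIndexSum h ⟩
    qint h                                            ∎

  esym : List Carrier → ℕ → Carrier
  esym []       zero    = 1#
  esym []       (suc r) = 0#
  esym (x ∷ xs) zero    = esym xs zero
  esym (x ∷ xs) (suc r) = esym xs (suc r) ⊕ x ⊗ esym xs r

  esym-zero : ∀ xs → esym xs 0 ≈ 1#
  esym-zero []       = refl
  esym-zero (x ∷ xs) = esym-zero xs

  esym-vanish : ∀ xs r → length xs < r → esym xs r ≈ 0#
  esym-vanish []       (suc r) _           = refl
  esym-vanish (x ∷ xs) (suc r) (s≤s len<r) = trans
    (+-cong (esym-vanish xs (suc r) (m≤n⇒m≤1+n len<r)) (trans (*-congˡ (esym-vanish xs r len<r)) (zeroʳ x)))
    (+-identityʳ 0#)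

  cq-vanish : ∀ n k → n < k → cq n k ≈ 0#
  cq-vanish zero    (suc k) _         = refl
  cq-vanish (suc n) (suc k) (s≤s n<k) = trans
    (+-cong (cq-vanish n k n<k) (trans (*-congˡ (cq-vanish n (suc k) (m≤n⇒m≤1+n n<k))) (zeroʳ _)))
    (+-identityʳ 0#)

  cq-diag : ∀ n → cq n n ≈ 1#
  cq-diag zero    = refl
  cq-diag (suc n) = trans (+-cong (cq-diag n) (trans (*-congˡ (cq-vanish n (suc n) ≤-refl)) (zeroʳ _))) (+-identityʳ 1#)

  qintsDown : ℕ → List Carrier
  qintsDown = applyDownFrom (qint ∘ suc)

  stirling-diag : ∀ t → cq (suc t) (suc t) ≈ esym (qintsDown t) (t ∸ t)
  stirling-diag t = begin
    cq (suc t) (suc t)         ≈⟨ cq-diag (suc t) ⟩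
    1#                         ≈⟨ esym-zero (qintsDown t) ⟨
    esym (qintsDown t) 0       ≡⟨ ≡.cong (esym (qintsDown t)) (n∸n≡0 t) ⟨
    esym (qintsDown t) (t ∸ t) ∎

  stirling-esym : ∀ t k → k ≤ suc t → cq (suc t) k ≈ esym (qintsDown t) (suc t ∸ k)
  stirling-esym t zero _ =
    sym (esym-vanish (qintsDown t) (suc t) (s≤s (≤-reflexive (length-applyDownFrom (qint ∘ suc) t))))
  stirling-esym zero (suc zero) _ = stirling-diag zero
  stirling-esym zero (suc (suc k)) (s≤s ())
  stirling-esym (suc t) (suc k) (s≤s k≤1+t) with m≤n⇒m<n∨m≡n k≤1+t
  ... | inj₂ ≡.refl = stirling-diag (suc t)
  ... | inj₁ (s≤s k≤t) = begin
    cq (suc t) k ⊕ qint (suc t) ⊗ cq (suc t) (suc k)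
      ≈⟨ +-cong (stirling-esym t k (m≤n⇒m≤1+n k≤t)) (*-congˡ (stirling-esym t (suc k) (s≤s k≤t))) ⟩
    esym xs (suc t ∸ k) ⊕ qint (suc t) ⊗ esym xs (t ∸ k)
      ≡⟨ ≡.cong (λ r → esym xs r ⊕ qint (suc t) ⊗ esym xs (t ∸ k)) (+-∸-assoc 1 k≤t) ⟩
    esym (qint (suc t) ∷ xs) (suc (t ∸ k))
      ≡⟨ ≡.cong (esym (qint (suc t) ∷ xs)) (≡.sym (+-∸-assoc 1 k≤t)) ⟩
    esym (qint (suc t) ∷ xs) (suc t ∸ k) ∎
    where xs = qintsDown t

  columnHeights : ℕ → ℕ → ℕ → List ℕ
  columnHeights m zero    j = []
  columnHeights m (suc t) j = (m ∸ j) ∷ columnHeights m t (suc j)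

  columnHeights-staircase : ∀ m t j → m ∸ j ≡ t → map qint (columnHeights m t j) ≡ qintsDown t
  columnHeights-staircase m zero    j _ = ≡.refl
  columnHeights-staircase m (suc t) j e = ≡.cong₂ _∷_ (≡.cong qint e)
    (columnHeights-staircase m t (suc j) (≡.trans (≡.sym (pred[m∸n]≡m∸[1+n] m j)) (≡.cong pred e)))

  module Board (m : ℕ) where

    contribution : ℕ → Placement → Carrier
    contribution r T = if length T ≡ᵇ r then (if allᵇ (shaded m) T then weight m T else 0#) else 0#

    rookSumOver : List Placement → ℕ → Carrier
    rookSumOver Ts r = sumList (map (contribution r) Ts)

    filtered≈rookSumOver : ∀ r Ts →
      sumList (map (weight m) (filterᵇ (allᵇ (shaded m)) (filterᵇ (λ T → length T ≡ᵇ r) Ts))) ≈ rookSumOver Ts r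
    filtered≈rookSumOver r [] = refl
    filtered≈rookSumOver r (T ∷ Ts) with length T ≡ᵇ r
    ... | false = trans (filtered≈rookSumOver r Ts) (sym (+-identityˡ _))
    ... | true with allᵇ (shaded m) T
    ...   | false = trans (filtered≈rookSumOver r Ts) (sym (+-identityˡ _))
    ...   | true  = +-congˡ (filtered≈rookSumOver r Ts)

    rookSumOver-concat : ∀ (f : Placement → List Placement) Ts r →
      rookSumOver (concat (map f Ts)) r ≈ sumList (map (λ T → rookSumOver (f T) r) Ts)
    rookSumOver-concat f []       r = refl
    rookSumOver-concat f (T ∷ Ts) r =
      trans (sum-++ (contribution r) (f T) (concat (map f Ts))) (+-congˡ (rookSumOver-concat f Ts r))

    nrow-∷ : ∀ i j T → nrow ((i , j) ∷ T) ≡ offTop i +ℕ nrow T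
    nrow-∷ i j T with i ≡ᵇ 1
    ... | true  = ≡.refl
    ... | false = ≡.refl

    rookFactor : ℕ → ℕ → Carrier
    rookFactor i j = pow q (belowSq m (i , j)) ⊗ pow (1# ⊕ q) (offTop i)

    weight-∷ : ∀ i j T → weight m ((i , j) ∷ T) ≈ rookFactor i j ⊗ weight m T
    weight-∷ i j T = begin
      pow q (belowSq m (i , j) +ℕ below m T) ⊗ pow (1# ⊕ q) (nrow ((i , j) ∷ T))
        ≈⟨ *-cong (pow-+ q (belowSq m (i , j)) (below m T))
                  (trans (reflexive (≡.cong (pow (1# ⊕ q)) (nrow-∷ i j T))) (pow-+ (1# ⊕ q) (offTop i) (nrow T))) ⟩
      (pow q (belowSq m (i , j)) ⊗ pow q (below m T)) ⊗ (pow (1# ⊕ q) (offTop i) ⊗ pow (1# ⊕ q) (nrow T))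
        ≈⟨ interchange _ _ _ _ ⟩
      rookFactor i j ⊗ weight m T ∎

    cellWeight-board : ∀ j i → (if shaded m (i , j) then rookFactor i j else 0#) ≡ cellWeight (m ∸ j) i
    cellWeight-board j i rewrite +ℕ-comm i j | ≡.sym (∸-+-assoc m j i) = ≡.refl

    contribution-∷ : ∀ r i j T → contribution (suc r) ((i , j) ∷ T) ≈ cellWeight (m ∸ j) i ⊗ contribution r T
    contribution-∷ r i j T rewrite ≡.sym (cellWeight-board j i) with length T ≡ᵇ r
    ... | false = sym (zeroʳ _)
    ... | true with shaded m (i , j)
    ...   | false = sym (zeroˡ _)
    ...   | true with allᵇ (shaded m) T
    ...     | false = sym (zeroʳ _)
    ...     | true  = weight-∷ i j T

    extensions : ℕ → Placement → List Placement
    extensions j T = T ∷ map (λ i → (i , j) ∷ T) (rows (m ∸ j))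

    extensions-zero : ∀ j T → rookSumOver (extensions j T) 0 ≈ contribution 0 T
    extensions-zero j T = trans (+-congˡ (trans (reflexive (≡.cong sumList (≡.sym (map-∘ (rows (m ∸ j))))))
                                               (sum-zero (rows (m ∸ j)))))
                                (+-identityʳ _)

    extensions-suc : ∀ j T r → rookSumOver (extensions j T) (suc r) ≈ contribution (suc r) T ⊕ qint (m ∸ j) ⊗ contribution r T
    extensions-suc j T r = +-congˡ (begin
      sumList (map (contribution (suc r)) (map (λ i → (i , j) ∷ T) (rows (m ∸ j))))
        ≡⟨ ≡.cong sumList (≡.sym (map-∘ (rows (m ∸ j)))) ⟩
      sumList (map (λ i → contribution (suc r) ((i , j) ∷ T)) (rows (m ∸ j)))
        ≈⟨ sum-cong (λ i → contribution-∷ r i j T) (rows (m ∸ j)) ⟩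
      sumList (map (λ i → cellWeight (m ∸ j) i ⊗ contribution r T) (rows (m ∸ j)))
        ≈⟨ sum-*ʳ (contribution r T) (cellWeight (m ∸ j)) (rows (m ∸ j)) ⟩
      sumList (map (cellWeight (m ∸ j)) (rows (m ∸ j))) ⊗ contribution r T
        ≈⟨ *-congʳ (columnSum (m ∸ j)) ⟩
      qint (m ∸ j) ⊗ contribution r T ∎)

    placements-esym : ∀ t j r → rookSumOver (placementsFrom m t j) r ≈ esym (map qint (columnHeights m t j)) r
    placements-esym zero    j zero    = trans (+-identityʳ _) (*-identityˡ _)
    placements-esym zero    j (suc r) = +-identityʳ _
    placements-esym (suc t) j r = trans (rookSumOver-concat (extensions j) Ts r) (byRooks r)
      where
      Ts = placementsFrom m t (suc j)
      byRooks : ∀ r → sumList (map (λ T → rookSumOver (extensions j T) r) Ts)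
                      ≈ esym (map qint (columnHeights m (suc t) j)) r
      byRooks zero    = trans (sum-cong (extensions-zero j) Ts) (placements-esym t (suc j) zero)
      byRooks (suc r) = begin
        sumList (map (λ T → rookSumOver (extensions j T) (suc r)) Ts)
          ≈⟨ sum-cong (λ T → extensions-suc j T r) Ts ⟩
        sumList (map (λ T → contribution (suc r) T ⊕ qint (m ∸ j) ⊗ contribution r T) Ts)
          ≈⟨ sum-+ _ _ Ts ⟩
        rookSumOver Ts (suc r) ⊕ sumList (map (λ T → qint (m ∸ j) ⊗ contribution r T) Ts)
          ≈⟨ +-congˡ (sum-*ˡ (qint (m ∸ j)) (contribution r) Ts) ⟩
        rookSumOver Ts (suc r) ⊕ qint (m ∸ j) ⊗ rookSumOver Ts r
          ≈⟨ +-cong (placements-esym t (suc j) (suc r)) (*-congˡ (placements-esym t (suc j) r)) ⟩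
        esym (map qint (columnHeights m (suc t) j)) (suc r) ∎

theorem7p4 : {c ℓ : Level} (S : CommutativeSemiring c ℓ) (q : CommutativeSemiring.Carrier S)
    → (n k : ℕ) → 1 ≤ n → k ≤ n
    → CommutativeSemiring._≈_ S (Poly.cq S q n k) (Poly.rookSum S q n (n ∸ k))
-- Both sides equal e_{n-k}([n-1]_q, …, [1]_q).
theorem7p4 S q (suc t) k _ k≤n = begin
  cq (suc t) k                                                 ≈⟨ stirling-esym t k k≤n ⟩
  esym (qintsDown t) (suc t ∸ k)                               ≡⟨ ≡.cong (λ xs → esym xs (suc t ∸ k)) staircase ⟨
  esym (map qint (columnHeights (suc t) t 1)) (suc t ∸ k)      ≈⟨ placements-esym t 1 (suc t ∸ k) ⟨
  rookSumOver (allPlacements (suc t)) (suc t ∸ k)              ≈⟨ filtered≈rookSumOver (suc t ∸ k) (allPlacements (suc t)) ⟨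
  rookSum (suc t) (suc t ∸ k)                                  ∎
  where
  open CommutativeSemiring S using (setoid)
  open SetoidReasoning setoid
  open Poly S q using (cq; qint; rookSum)
  open RookStirling S q
  open Board (suc t)
  staircase : map qint (columnHeights (suc t) t 1) ≡ qintsDown t
  staircase = columnHeights-staircase (suc t) t 1 ≡.refl
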